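{- Let $S$ and $S'$ be disjoint finite sets with $|S|\geq 3$ and $|S'|=\lceil\log_2(|S|+1)\rceil$. Then there is a prime graph $G$ with $V(G)=S\cup S'$ such that: $S$ and $S'$ are stable sets in $G$; the map $s\mapsto N_G(s)$ is an injection from $S$ into $2^{S'}\setminus\{\emptyset\}$; and there is an injection $\varphi:S'\to S$ with $N_G(\varphi(s'))=S'\setminus\{s'\}$ for every $s'\in S'$.
   Context: Graphs are simple and undirected; $N_G(v)$ is the set of neighbours of $v$. A module of $G$ is a set $M\subseteq V(G)$ such that each vertex outside $M$ is adjacent to all or none of $M$; trivial modules are $\emptyset$, $V(G)$, singletons. $G$ is prime if $|V(G)|\geq 4$ and all its modules are trivial. -}

module Defs where

open import Data.Nat using (ℕ; _≤_; _+_)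
open import Data.Bool using (Bool; true; false)
open import Data.Fin using (Fin)
open import Data.Sum using (_⊎_; inj₁; inj₂)
open import Data.Product using (_×_; ∃; Σ; _,_)
open import Data.Empty using (⊥)
open import Relation.Nullary using (¬_)
open import Relation.Binary.PropositionalEquality using (_≡_; _≢_)
open import Function.Bundles using (_⇔_)

record Graph (V : Set) : Set where
  field
    adj   : V → V → Bool
    sym   : ∀ x y → adj x y ≡ adj y x
    irrefl : ∀ x → adj x x ≡ false
open Graph public

Subset : Set → Set
Subset V = V → Bool

N : ∀ {V} → Graph V → V → Subset V
N G v = λ u → adj G v u

IsModule : ∀ {V} → Graph V → Subset V → Set
IsModule G M = ∀ x → M x ≡ false →
  ∀ y z → M y ≡ true → M z ≡ true → adj G x y ≡ adj G x z

IsTrivial : ∀ {V} → Subset V → Set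
IsTrivial {V} M =
  (∀ x → M x ≡ false) ⊎ ((∀ x → M x ≡ true) ⊎
  (∃ λ (v : V) → ∀ x → (M x ≡ true) ⇔ (x ≡ v)))

IsPrime : ∀ {V} → ℕ → Graph V → Set
IsPrime k G = (4 ≤ k) × (∀ M → IsModule G M → IsTrivial M)

module Submission where

-- G is bipartite between S = Fin n and S' = Fin m: s is joined to the positions of the zero bits
-- of e(s), where e : Fin n → [0, 2^m − 2] is injective and its image contains 0 and every 2^j
-- (j < m). So neighbourhoods are distinct and nonempty, the vertex with e = 0 sees all of S', and
-- the vertex with e = 2^j sees exactly S' ∖ {j}. Any two distinct vertices of a module are split by
-- an outside vertex (a bit where their codes differ, or the vertex with e = 2^j), so the module
-- meets both sides; then it contains the vertex seeing all of S', hence all of S', hence all of S.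
-- Such an e exists because m = ⌈log₂(n+1)⌉ means 2^(m−1) ≤ n < 2^m: take the identity below n − 1
-- and send n − 1 to max(n − 1, 2^(m−1)).

open import Defs
open import Data.Bool using (Bool; true; false; not)
open import Data.Bool.Properties using (¬-not; not-injective) renaming (_≟_ to _≟ᵇ_)
open import Data.Fin using (Fin; toℕ; fromℕ<) renaming (zero to fzero; suc to fsuc)
open import Data.Fin.Properties using (any?; ¬∀⟶∃¬; toℕ-injective; toℕ<n; toℕ-fromℕ<)
  renaming (_≟_ to _≟ᶠ_)
open import Data.Nat using (ℕ; zero; suc; _+_; _*_; _^_; _⊔_; _≤_; _<_; z≤n; s≤s; ⌊_/2⌋; ⌈_/2⌉)
open import Data.Nat.Properties hiding (_≟_)
open import Data.Nat.Logarithm using (⌈log₂_⌉; ⌈log₂⌉-mono-≤; ⌈log₂⌈n/2⌉⌉≡⌈log₂n⌉∸1; ⌈log₂2^n⌉≡n)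
open import Data.Product using (_×_; ∃; Σ; _,_; proj₁; proj₂)
open import Data.Sum using (_⊎_; inj₁; inj₂)
open import Data.Sum.Properties using (≡-dec)
open import Function using (_∘_)
open import Function.Bundles using (_⇔_; mk⇔)
open import Level using (0ℓ)
open import Relation.Binary.Definitions using (DecidableEquality; tri<; tri≈; tri>)
open import Relation.Binary.PropositionalEquality renaming (sym to ≡-sym)
open import Relation.Nullary using (Dec; yes; no; contradiction)
open import Relation.Nullary.Decidable using (map′; decidable-stable; ¬?; _×-dec_; _⊎-dec_)
open import Relation.Unary using (Pred; Decidable)

module-closed : ∀ {V} (G : Graph V) {M : Subset V} → IsModule G M →
  ∀ {x y z} → M x ≡ true → M y ≡ true → adj G z x ≢ adj G z y → M z ≡ true
module-closed _ {M} mod {x} {y} {z} x∈M y∈M z-splits with M z in z∈?M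
... | true  = refl
... | false = contradiction (mod z z∈?M x y x∈M y∈M) z-splits

full-on-pairs⇒trivial : ∀ {V : Set} → DecidableEquality V →
  (∀ {P : Pred V 0ℓ} → Decidable P → Dec (∃ P)) → (M : Subset V) →
  (∀ {x y} → x ≢ y → M x ≡ true → M y ≡ true → ∀ v → M v ≡ true) →
  IsTrivial M
full-on-pairs⇒trivial _≟_ search M pair⇒full with search (λ x → M x ≟ᵇ true)
... | no  empty   = inj₁ λ x → ¬-not (empty ∘ (x ,_))
... | yes (x , x∈M) with search (λ y → ¬? (y ≟ x) ×-dec M y ≟ᵇ true)
...   | yes (y , y≢x , y∈M) = inj₂ (inj₁ (pair⇒full y≢x y∈M x∈M))
...   | no  alone           = inj₂ (inj₂ (x , λ z → mk⇔
          (λ z∈M → decidable-stable (z ≟ x) (λ z≢x → alone (z , z≢x , z∈M)))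
          (λ { refl → x∈M })))

any⊎? : ∀ {a b} {P : Pred (Fin a ⊎ Fin b) 0ℓ} → Decidable P → Dec (∃ P)
any⊎? P? = map′ (λ { (inj₁ (i , p)) → inj₁ i , p ; (inj₂ (j , p)) → inj₂ j , p })
                (λ { (inj₁ i , p) → inj₁ (i , p) ; (inj₂ j , p) → inj₂ (j , p) })
                (any? (P? ∘ inj₁) ⊎-dec any? (P? ∘ inj₂))

bipartite : ∀ {A B : Set} → (A → B → Bool) → Graph (A ⊎ B)
bipartite code .adj (inj₁ _) (inj₁ _) = false
bipartite code .adj (inj₁ a) (inj₂ b) = code a b
bipartite code .adj (inj₂ b) (inj₁ a) = code a b
bipartite code .adj (inj₂ _) (inj₂ _) = false
bipartite code .sym (inj₁ _) (inj₁ _) = refl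
bipartite code .sym (inj₁ _) (inj₂ _) = refl
bipartite code .sym (inj₂ _) (inj₁ _) = refl
bipartite code .sym (inj₂ _) (inj₂ _) = refl
bipartite code .irrefl (inj₁ _) = refl
bipartite code .irrefl (inj₂ _) = refl

record PrimeBipartiteCode {A B : Set} (code : A → B → Bool) : Set where
  field
    universal         : A
    universal-full    : ∀ b → code universal b ≡ true
    nonempty          : ∀ a → ∃ λ b → code a b ≡ true
    separating        : ∀ {a a′} → a ≢ a′ → ∃ λ b → code a b ≢ code a′ b
    cosingleton       : B → A
    cosingleton-self  : ∀ b → code (cosingleton b) b ≡ false
    cosingleton-other : ∀ {b b′} → b′ ≢ b → code (cosingleton b) b′ ≡ true

≡true⇒≡false⇒≢ : ∀ {x y} → x ≡ true → y ≡ false → x ≢ y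
≡true⇒≡false⇒≢ refl refl ()

module _ {A B : Set} {code : A → B → Bool} (pc : PrimeBipartiteCode code) where
  open PrimeBipartiteCode pc

  private
    G : Graph (A ⊎ B)
    G = bipartite code

  module _ {M : Subset (A ⊎ B)} (mod : IsModule G M) where

    closed : ∀ {x y z} → M x ≡ true → M y ≡ true → adj G z x ≢ adj G z y → M z ≡ true
    closed = module-closed G mod

    mixed⇒full : ∀ {a b} → M (inj₁ a) ≡ true → M (inj₂ b) ≡ true → ∀ v → M v ≡ true
    mixed⇒full {a} {b} a∈M b∈M = everything
      where
      universal∈M : M (inj₁ universal) ≡ true
      universal∈M = closed b∈M a∈M (≡true⇒≡false⇒≢ (universal-full b) refl)
      everything : ∀ v → M v ≡ true
      everything (inj₂ b′) = closed universal∈M b∈M (≡true⇒≡false⇒≢ (universal-full b′) refl)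
      everything (inj₁ a′) with nonempty a′
      ... | b′ , a′~b′ = closed (everything (inj₂ b′)) universal∈M (≡true⇒≡false⇒≢ a′~b′ refl)

    pair⇒full : ∀ {x y} → x ≢ y → M x ≡ true → M y ≡ true → ∀ v → M v ≡ true
    pair⇒full {inj₁ a} {inj₂ b} _ a∈M b∈M = mixed⇒full a∈M b∈M
    pair⇒full {inj₂ b} {inj₁ a} _ b∈M a∈M = mixed⇒full a∈M b∈M
    pair⇒full {inj₁ a} {inj₁ a′} a≢a′ a∈M a′∈M with separating (a≢a′ ∘ cong inj₁)
    ... | b , b-splits = mixed⇒full a∈M (closed a∈M a′∈M b-splits)
    pair⇒full {inj₂ b} {inj₂ b′} b≢b′ b∈M b′∈M =
      mixed⇒full (closed b′∈M b∈M φb-splits) b∈M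
      where
      φb-splits : code (cosingleton b) b′ ≢ code (cosingleton b) b
      φb-splits = ≡true⇒≡false⇒≢ (cosingleton-other (≢-sym (b≢b′ ∘ cong inj₂))) (cosingleton-self b)

  cosingleton-injective : DecidableEquality B → ∀ b b′ → cosingleton b ≡ cosingleton b′ → b ≡ b′
  cosingleton-injective _≟_ b b′ φb≡φb′ = decidable-stable (b ≟ b′) λ b≢b′ →
    ≡true⇒≡false⇒≢ (cosingleton-other b≢b′) (cosingleton-self b)
      (cong (λ a → code a b) (≡-sym φb≡φb′))

  N-injective : DecidableEquality A → ∀ a a′ → (∀ v → N G (inj₁ a) v ≡ N G (inj₁ a′) v) → a ≡ a′
  N-injective _≟_ a a′ sameN = decidable-stable (a ≟ a′) λ a≢a′ →
    let b , b-splits = separating a≢a′ in b-splits (sameN (inj₂ b))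

  N-cosingleton : ∀ b v →
    (N G (inj₁ (cosingleton b)) v ≡ true) ⇔ (∃ λ b′ → (v ≡ inj₂ b′) × (b′ ≢ b))
  N-cosingleton b (inj₁ a)  = mk⇔ (λ ()) (λ { (_ , () , _) })
  N-cosingleton b (inj₂ b′) = mk⇔
    (λ φb~b′ → b′ , refl , λ { refl → ≡true⇒≡false⇒≢ φb~b′ (cosingleton-self b) refl })
    (λ { (_ , refl , b′≢b) → cosingleton-other b′≢b })

bipartite-modules-trivial : ∀ {a b} {code : Fin a → Fin b → Bool} → PrimeBipartiteCode code →
  ∀ M → IsModule (bipartite code) M → IsTrivial M
bipartite-modules-trivial pc M mod =
  full-on-pairs⇒trivial (≡-dec _≟ᶠ_ _≟ᶠ_) any⊎? M (pair⇒full pc mod)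

odd : ℕ → Bool
odd 0             = false
odd 1             = true
odd (suc (suc n)) = odd n

testBit : ℕ → ℕ → Bool
testBit i zero    = odd i
testBit i (suc j) = testBit ⌊ i /2⌋ j

odd-⌊n/2⌋-injective : ∀ {i k} → odd i ≡ odd k → ⌊ i /2⌋ ≡ ⌊ k /2⌋ → i ≡ k
odd-⌊n/2⌋-injective {0}           {0}           _ _ = refl
odd-⌊n/2⌋-injective {1}           {1}           _ _ = refl
odd-⌊n/2⌋-injective {suc (suc i)} {suc (suc k)} o h =
  cong (suc ∘ suc) (odd-⌊n/2⌋-injective o (suc-injective h))
odd-⌊n/2⌋-injective {0}           {1}           () _
odd-⌊n/2⌋-injective {1}           {0}           () _
odd-⌊n/2⌋-injective {0}           {suc (suc _)} _ ()
odd-⌊n/2⌋-injective {1}           {suc (suc _)} _ ()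
odd-⌊n/2⌋-injective {suc (suc _)} {0}           _ ()
odd-⌊n/2⌋-injective {suc (suc _)} {1}           _ ()

odd⇒n≡1+2*⌊n/2⌋ : ∀ {n} → odd n ≡ true → n ≡ suc (2 * ⌊ n /2⌋)
odd⇒n≡1+2*⌊n/2⌋ {1}           _ = refl
odd⇒n≡1+2*⌊n/2⌋ {suc (suc n)} o = begin
  suc (suc n)                   ≡⟨ cong (suc ∘ suc) (odd⇒n≡1+2*⌊n/2⌋ o) ⟩
  suc (suc (suc (2 * ⌊ n /2⌋))) ≡⟨ cong suc (*-suc 2 ⌊ n /2⌋) ⟨
  suc (2 * suc ⌊ n /2⌋)         ∎
  where open ≡-Reasoning

2*⌊n/2⌋≤n : ∀ n → 2 * ⌊ n /2⌋ ≤ n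
2*⌊n/2⌋≤n 0             = z≤n
2*⌊n/2⌋≤n 1             = z≤n
2*⌊n/2⌋≤n (suc (suc n)) rewrite *-suc 2 ⌊ n /2⌋ = s≤s (s≤s (2*⌊n/2⌋≤n n))

n<2*m⇒⌊n/2⌋<m : ∀ {n m} → n < 2 * m → ⌊ n /2⌋ < m
n<2*m⇒⌊n/2⌋<m {n} n<2m = *-cancelˡ-< 2 _ _ (≤-<-trans (2*⌊n/2⌋≤n n) n<2m)

⌊2*n/2⌋≡n : ∀ n → ⌊ 2 * n /2⌋ ≡ n
⌊2*n/2⌋≡n n rewrite +-identityʳ n = ≡-sym (n≡⌊n+n/2⌋ n)

odd[2*n]≡false : ∀ n → odd (2 * n) ≡ false
odd[2*n]≡false zero    = refl
odd[2*n]≡false (suc n) rewrite *-suc 2 n = odd[2*n]≡false n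

testBit-0 : ∀ j → testBit 0 j ≡ false
testBit-0 zero    = refl
testBit-0 (suc j) = testBit-0 j

testBit-2^-self : ∀ j → testBit (2 ^ j) j ≡ true
testBit-2^-self zero    = refl
testBit-2^-self (suc j) rewrite ⌊2*n/2⌋≡n (2 ^ j) = testBit-2^-self j

testBit-2^-other : ∀ {j k} → k ≢ j → testBit (2 ^ j) k ≡ false
testBit-2^-other {zero}  {zero}  k≢j = contradiction refl k≢j
testBit-2^-other {zero}  {suc k} _   = testBit-0 k
testBit-2^-other {suc j} {zero}  _   = odd[2*n]≡false (2 ^ j)
testBit-2^-other {suc j} {suc k} k≢j rewrite ⌊2*n/2⌋≡n (2 ^ j) =
  testBit-2^-other (k≢j ∘ cong suc)

testBit-injective : ∀ m {i k} → i < 2 ^ m → k < 2 ^ m →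
  (∀ (j : Fin m) → testBit i (toℕ j) ≡ testBit k (toℕ j)) → i ≡ k
testBit-injective zero    {0}     {0}     _         _         _ = refl
testBit-injective zero    {suc _} {_}     (s≤s ()) _         _
testBit-injective zero    {_}     {suc _} _         (s≤s ()) _
testBit-injective (suc m) i< k< same = odd-⌊n/2⌋-injective (same fzero)
  (testBit-injective m (n<2*m⇒⌊n/2⌋<m i<) (n<2*m⇒⌊n/2⌋<m k<) (same ∘ fsuc))

testBits-true⇒2^m≤1+n : ∀ m {n} → (∀ (j : Fin m) → testBit n (toℕ j) ≡ true) → 2 ^ m ≤ suc n
testBits-true⇒2^m≤1+n zero    _    = s≤s z≤n
testBits-true⇒2^m≤1+n (suc m) {n} ones = begin
  2 * 2 ^ m               ≤⟨ *-monoʳ-≤ 2 (testBits-true⇒2^m≤1+n m (ones ∘ fsuc)) ⟩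
  2 * suc ⌊ n /2⌋         ≡⟨ *-suc 2 ⌊ n /2⌋ ⟩
  suc (suc (2 * ⌊ n /2⌋)) ≡⟨ cong suc (odd⇒n≡1+2*⌊n/2⌋ (ones fzero)) ⟨
  suc n                   ∎
  where open ≤-Reasoning

testBit-false : ∀ m {n} → suc n < 2 ^ m → ∃ λ (j : Fin m) → testBit n (toℕ j) ≡ false
testBit-false m {n} 1+n<2^m =
  let j , bit≢true = ¬∀⟶∃¬ m _ (λ j → testBit n (toℕ j) ≟ᵇ true)
                       (<⇒≱ 1+n<2^m ∘ testBits-true⇒2^m≤1+n m)
  in j , ¬-not bit≢true

testBit-separates : ∀ m {i k} → i < 2 ^ m → k < 2 ^ m → i ≢ k →
  ∃ λ (j : Fin m) → testBit i (toℕ j) ≢ testBit k (toℕ j)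
testBit-separates m {i} {k} i< k< i≢k =
  ¬∀⟶∃¬ m _ (λ j → testBit i (toℕ j) ≟ᵇ testBit k (toℕ j)) (i≢k ∘ testBit-injective m i< k<)

open PrimeBipartiteCode

bitComplementCode : ∀ {n m} → (Fin n → ℕ) → Fin n → Fin m → Bool
bitComplementCode e i j = not (testBit (e i) (toℕ j))

bitComplementCode-prime : ∀ {n m} (e : Fin n → ℕ) →
  (∀ {i k} → e i ≡ e k → i ≡ k) → (∀ i → suc (e i) < 2 ^ m) →
  (∃ λ i → e i ≡ 0) → (∀ (j : Fin m) → ∃ λ i → e i ≡ 2 ^ toℕ j) →
  PrimeBipartiteCode (bitComplementCode {m = m} e)
bitComplementCode-prime _ _ _ (i₀ , _) _ .universal = i₀
bitComplementCode-prime _ _ _ (_ , e[i₀]≡0) _ .universal-full j rewrite e[i₀]≡0 =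
  cong not (testBit-0 (toℕ j))
bitComplementCode-prime {m = m} _ _ e-bounded _ _ .nonempty i =
  let j , bit≡false = testBit-false m (e-bounded i) in j , cong not bit≡false
bitComplementCode-prime {m = m} _ e-injective e-bounded _ _ .separating i≢k =
  let j , bits-differ =
        testBit-separates m (<⇒≤ (e-bounded _)) (<⇒≤ (e-bounded _)) (i≢k ∘ e-injective)
  in j , bits-differ ∘ not-injective
bitComplementCode-prime _ _ _ _ powers .cosingleton j = proj₁ (powers j)
bitComplementCode-prime _ _ _ _ powers .cosingleton-self j rewrite proj₂ (powers j) =
  cong not (testBit-2^-self (toℕ j))
bitComplementCode-prime _ _ _ _ powers .cosingleton-other {j} k≢j rewrite proj₂ (powers j) =
  cong not (testBit-2^-other (k≢j ∘ toℕ-injective))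

n≤2*⌈n/2⌉ : ∀ n → n ≤ 2 * ⌈ n /2⌉
n≤2*⌈n/2⌉ n = begin
  n                       ≡⟨ ⌊n/2⌋+⌈n/2⌉≡n n ⟨
  ⌊ n /2⌋ + ⌈ n /2⌉       ≤⟨ +-monoˡ-≤ ⌈ n /2⌉ (⌊n/2⌋≤⌈n/2⌉ n) ⟩
  ⌈ n /2⌉ + ⌈ n /2⌉       ≡⟨ cong (⌈ n /2⌉ +_) (+-identityʳ ⌈ n /2⌉) ⟨
  2 * ⌈ n /2⌉             ∎
  where open ≤-Reasoning

⌈log₂n⌉≤c⇒n≤2^c : ∀ c n → ⌈log₂ n ⌉ ≤ c → n ≤ 2 ^ c
⌈log₂n⌉≤c⇒n≤2^c zero    0             _ = z≤n
⌈log₂n⌉≤c⇒n≤2^c zero    1             _ = s≤s z≤n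
⌈log₂n⌉≤c⇒n≤2^c zero    (suc (suc n)) ⌈log₂n⌉≤0 =
  contradiction (≤-trans (⌈log₂⌉-mono-≤ {2} {2 + n} (s≤s (s≤s z≤n))) ⌈log₂n⌉≤0) λ ()
⌈log₂n⌉≤c⇒n≤2^c (suc c) n ⌈log₂n⌉≤1+c = begin
  n               ≤⟨ n≤2*⌈n/2⌉ n ⟩
  2 * ⌈ n /2⌉     ≤⟨ *-monoʳ-≤ 2 (⌈log₂n⌉≤c⇒n≤2^c c ⌈ n /2⌉ ⌈log₂⌈n/2⌉⌉≤c) ⟩
  2 * 2 ^ c       ∎
  where
  open ≤-Reasoning
  ⌈log₂⌈n/2⌉⌉≤c : ⌈log₂ ⌈ n /2⌉ ⌉ ≤ c
  ⌈log₂⌈n/2⌉⌉≤c = subst (_≤ c) (≡-sym (⌈log₂⌈n/2⌉⌉≡⌈log₂n⌉∸1 n)) (∸-monoˡ-≤ 1 ⌈log₂n⌉≤1+c)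

⌈log₂[n+1]⌉≡1+k : ∀ n → 0 < n → ∃ λ k → ⌈log₂ (n + 1)⌉ ≡ suc k × 2 ^ k ≤ n × n < 2 ^ suc k
⌈log₂[n+1]⌉≡1+k n 0<n with ⌈log₂ (n + 1)⌉ in eq
... | zero  = contradiction (+-cancelʳ-≤ 1 n 0 (⌈log₂n⌉≤c⇒n≤2^c 0 (n + 1) (≤-reflexive eq)))
                (<⇒≱ 0<n)
... | suc k = k , refl , 2^k≤n , subst (_≤ 2 ^ suc k) (+-comm n 1) n+1≤2^[1+k]
  where
  n+1≤2^[1+k] : n + 1 ≤ 2 ^ suc k
  n+1≤2^[1+k] = ⌈log₂n⌉≤c⇒n≤2^c (suc k) (n + 1) (≤-reflexive eq)
  2^k≤n : 2 ^ k ≤ n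
  2^k≤n = ≮⇒≥ λ n<2^k → 1+n≰n (begin
    suc k             ≡⟨ eq ⟨
    ⌈log₂ (n + 1)⌉    ≤⟨ ⌈log₂⌉-mono-≤ (subst (_≤ 2 ^ k) (+-comm 1 n) n<2^k) ⟩
    ⌈log₂ (2 ^ k)⌉    ≡⟨ ⌈log₂2^n⌉≡n k ⟩
    k                 ∎)
    where open ≤-Reasoning

2*n≤1+n⇒n≤1 : ∀ {n} → 2 * n ≤ suc n → n ≤ 1
2*n≤1+n⇒n≤1 {n} 2n≤1+n = subst (_≤ 1) (+-identityʳ n)
  (+-cancelˡ-≤ n (n + 0) 1 (subst (2 * n ≤_) (+-comm 1 n) 2n≤1+n))

-- ℓ is the last vertex of S, so n = ℓ + 1 and m = k + 1.
module Encoding {ℓ k : ℕ} (2≤ℓ : 2 ≤ ℓ) (2^k≤1+ℓ : 2 ^ k ≤ suc ℓ) (1+ℓ<2^[1+k] : suc ℓ < 2 ^ suc k)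
  where

  encode : ℕ → ℕ
  encode i with i <? ℓ
  ... | yes _ = i
  ... | no  _ = i ⊔ 2 ^ k

  encode-below : ∀ {i} → i < ℓ → encode i ≡ i
  encode-below {i} i<ℓ with i <? ℓ
  ... | yes _   = refl
  ... | no  i≮ℓ = contradiction i<ℓ i≮ℓ

  encode-last : encode ℓ ≡ ℓ ⊔ 2 ^ k
  encode-last with ℓ <? ℓ
  ... | yes ℓ<ℓ = contradiction ℓ<ℓ (<-irrefl refl)
  ... | no  _   = refl

  i≤encode[i] : ∀ i → i ≤ encode i
  i≤encode[i] i with i <? ℓ
  ... | yes _ = ≤-refl
  ... | no  _ = m≤m⊔n i (2 ^ k)

  encode[i]≤i⊔2^k : ∀ i → encode i ≤ i ⊔ 2 ^ k
  encode[i]≤i⊔2^k i with i <? ℓ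
  ... | yes _ = m≤m⊔n i (2 ^ k)
  ... | no  _ = ≤-refl

  encode-strictMono : ∀ {i j} → i < j → j ≤ ℓ → encode i < encode j
  encode-strictMono {i} {j} i<j j≤ℓ = begin-strict
    encode i ≡⟨ encode-below (<-≤-trans i<j j≤ℓ) ⟩
    i        <⟨ i<j ⟩
    j        ≤⟨ i≤encode[i] j ⟩
    encode j ∎
    where open ≤-Reasoning

  encode-injective : ∀ {i j} → i ≤ ℓ → j ≤ ℓ → encode i ≡ encode j → i ≡ j
  encode-injective {i} {j} i≤ℓ j≤ℓ e≡ with <-cmp i j
  ... | tri< i<j _ _ = contradiction e≡ (<⇒≢ (encode-strictMono i<j j≤ℓ))
  ... | tri≈ _ i≡j _ = i≡j
  ... | tri> _ _ j<i = contradiction e≡ (>⇒≢ (encode-strictMono j<i i≤ℓ))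

  1<2^k : 1 < 2 ^ k
  1<2^k = *-cancelˡ-< 2 1 (2 ^ k) (<-trans (s≤s 2≤ℓ) 1+ℓ<2^[1+k])

  encode-bounded : ∀ {i} → i ≤ ℓ → suc (encode i) < 2 ^ suc k
  encode-bounded {i} i≤ℓ =
    ≤-trans (s≤s (s≤s (encode[i]≤i⊔2^k i)))
            (⊔-lub (≤-trans (s≤s (s≤s i≤ℓ)) 1+ℓ<2^[1+k]) 2+2^k≤2*2^k)
    where
    2+2^k≤2*2^k : 2 + 2 ^ k ≤ 2 * 2 ^ k
    2+2^k≤2*2^k = subst (2 + 2 ^ k ≤_) (cong (2 ^ k +_) (≡-sym (+-identityʳ (2 ^ k))))
                    (+-monoˡ-≤ (2 ^ k) 1<2^k)

  2^j≡2^k : ∀ {j} → j ≤ k → ℓ ≤ 2 ^ j → 2 ^ j ≡ 2 ^ k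
  2^j≡2^k {j} j≤k ℓ≤2^j with m≤n⇒m<n∨m≡n j≤k
  ... | inj₂ refl = refl
  ... | inj₁ j<k  = contradiction (≤-trans 2≤ℓ (≤-trans ℓ≤2^j 2^j≤1)) λ { (s≤s ()) }
    where
    2^j≤1 : 2 ^ j ≤ 1
    2^j≤1 = 2*n≤1+n⇒n≤1 (≤-trans (^-monoʳ-≤ 2 j<k) (≤-trans 2^k≤1+ℓ (s≤s ℓ≤2^j)))

  encode-hits-powers : ∀ {j} → j ≤ k → ∃ λ i → i ≤ ℓ × encode i ≡ 2 ^ j
  encode-hits-powers {j} j≤k with 2 ^ j <? ℓ
  ... | yes 2^j<ℓ = 2 ^ j , <⇒≤ 2^j<ℓ , encode-below 2^j<ℓ
  ... | no  2^j≮ℓ = ℓ , ≤-refl , (begin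
    encode ℓ    ≡⟨ encode-last ⟩
    ℓ ⊔ 2 ^ k   ≡⟨ m≤n⇒m⊔n≡n (subst (ℓ ≤_) 2^j≡2^k[j] ℓ≤2^j) ⟩
    2 ^ k       ≡⟨ 2^j≡2^k[j] ⟨
    2 ^ j       ∎)
    where
    open ≡-Reasoning
    ℓ≤2^j : ℓ ≤ 2 ^ j
    ℓ≤2^j = ≮⇒≥ 2^j≮ℓ
    2^j≡2^k[j] : 2 ^ j ≡ 2 ^ k
    2^j≡2^k[j] = 2^j≡2^k j≤k ℓ≤2^j

  code : Fin (suc ℓ) → Fin (suc k) → Bool
  code = bitComplementCode (encode ∘ toℕ)

  code-prime : PrimeBipartiteCode code
  code-prime = bitComplementCode-prime (encode ∘ toℕ)
    (λ {i} {j} → toℕ-injective ∘ encode-injective (≤-pred (toℕ<n i)) (≤-pred (toℕ<n j)))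
    (encode-bounded ∘ ≤-pred ∘ toℕ<n)
    (fzero , encode-below (≤-trans (s≤s z≤n) 2≤ℓ))
    λ j → let i , i≤ℓ , encode[i]≡2^j = encode-hits-powers (≤-pred (toℕ<n j))
          in fromℕ< (s≤s i≤ℓ) , trans (cong encode (toℕ-fromℕ< (s≤s i≤ℓ))) encode[i]≡2^j

corollary22 : (n m : ℕ) → 3 ≤ n → m ≡ ⌈log₂ (n + 1) ⌉ →
    Σ (Graph (Fin n ⊎ Fin m)) λ G →
      IsPrime (n + m) G
      × (∀ (s t : Fin n) → adj G (inj₁ s) (inj₁ t) ≡ false)
      × (∀ (s t : Fin m) → adj G (inj₂ s) (inj₂ t) ≡ false)
      × (∀ (s : Fin n) → ∃ λ (u : Fin m) → N G (inj₁ s) (inj₂ u) ≡ true)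
      × (∀ (s t : Fin n) → (∀ v → N G (inj₁ s) v ≡ N G (inj₁ t) v) → s ≡ t)
      × (Σ (Fin m → Fin n) λ φ →
          (∀ a b → φ a ≡ φ b → a ≡ b)
          × (∀ (s' : Fin m) v →
               (N G (inj₁ (φ s')) v ≡ true) ⇔ (∃ λ (u : Fin m) → (v ≡ inj₂ u) × (u ≢ s'))))
corollary22 (suc ℓ) m (s≤s 2≤ℓ) m≡⌈log₂⌉ with ⌈log₂[n+1]⌉≡1+k (suc ℓ) (s≤s z≤n)
... | k , ⌈log₂⌉≡1+k , 2^k≤n , n<2^[1+k] rewrite trans m≡⌈log₂⌉ ⌈log₂⌉≡1+k =
  bipartite code
  , (+-mono-≤ (s≤s 2≤ℓ) (s≤s z≤n) , bipartite-modules-trivial code-prime)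
  , (λ _ _ → refl) , (λ _ _ → refl)
  , nonempty code-prime
  , N-injective code-prime _≟ᶠ_
  , cosingleton code-prime , cosingleton-injective code-prime _≟ᶠ_ , N-cosingleton code-prime
  where
  open Encoding {k = k} 2≤ℓ 2^k≤n n<2^[1+k]
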